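{- In Ruleset B, a superposition $\langle \mathrm{Nim}(i_1),\dots,\mathrm{Nim}(i_\ell)\rangle_B$ of single Nim heaps with largest heap size $k=\max_{1\le j\le\ell} i_j\ge1$ has value $0$ if $k=2$, value $*$ if $k=1$, and value $*(k-1)$ otherwise (i.e. if $k\ge3$).
   Context: $\mathrm{Nim}(x)$ is a single Nim heap of $x$ tokens; a classical move $(1,-j)$, $j\ge1$, removes $j$ tokens and is legal iff $x\ge j$. Quantum variation: a quantum position is a finite nonempty set $\langle G_1,\dots,G_n\rangle$ of classical positions (multiplicities irrelevant). A classical move is legal in it if legal in at least one $G_i$. A Q-move is a finite nonempty set of classical moves, each legal in the current quantum position; it leads to the set of all positions obtained by applying one of its moves to one of the $G_i$ where that move is legal. A Q-move with a single classical move is unsuperposed. Ruleset B (subscript $B$): only Q-moves with at least two distinct classical moves are allowed, with the single exception that when the player has exactly one legal classical move in the quantum position, he may play it unsuperposed. Normal convention: a player with no allowed Q-move loses. $*n$ denotes the value (equivalence class under $G\equiv H$ iff $G+X$, $H+X$ have the same outcome for all games $X$) of a classical Nim heap of $n$ tokens, with $*0=0$, $*1=*$. -}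

module Defs where

open import Data.Nat using (ℕ; zero; suc; _∸_; _⊔_; _≤_; _≤?_)
open import Data.Bool using (Bool; true; false; not; _∨_)
open import Data.List using (List; []; _∷_; _++_; map; concatMap; filter; length; foldr)
open import Data.Product using (_×_)
open import Data.Sum using (_⊎_)
open import Relation.Binary.PropositionalEquality using (_≡_)
open import Relation.Nullary.Decidable using (_⊎-dec_; _×-dec_)
import Data.Nat as ℕ

-- Finite impartial games (normal play), as finitely branching game trees.

data Game : Set where
  node : List Game → Game

mutual
  _⊕_ : Game → Game → Game
  g@(node gs) ⊕ h@(node hs) = node (lefts gs h ++ rights g hs)

  lefts : List Game → Game → List Game
  lefts [] h = []
  lefts (g ∷ gs) h = (g ⊕ h) ∷ lefts gs h

  rights : Game → List Game → List Game
  rights g [] = []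
  rights g (h ∷ hs) = (g ⊕ h) ∷ rights g hs

mutual
  wins : Game → Bool
  wins (node gs) = someLoses gs

  someLoses : List Game → Bool
  someLoses [] = false
  someLoses (g ∷ gs) = not (wins g) ∨ someLoses gs

_≈G_ : Game → Game → Set
G ≈G H = ∀ (X : Game) → wins (G ⊕ X) ≡ wins (H ⊕ X)

mutual
  nim : ℕ → Game
  nim n = node (nims n)

  nims : ℕ → List Game
  nims zero = []
  nims (suc n) = nim n ∷ nims n

-- Quantum Nim superpositions of single heaps, Ruleset B.
-- A quantum position ⟨Nim(i₁),…,Nim(iₗ)⟩ is represented by the list of
-- heap sizes [i₁,…,iₗ] (order/multiplicity irrelevant).

maxL : List ℕ → ℕ
maxL = foldr _⊔_ 0

oneTo : ℕ → List ℕ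
oneTo zero = []
oneTo (suc k) = oneTo k ++ (suc k ∷ [])

-- Classical moves (1,-j) legal in the quantum position: 1 ≤ j ≤ max heap.
legalMoves : List ℕ → List ℕ
legalMoves S = oneTo (maxL S)

-- All sublists (subsets, as the list is duplicate-free).
subsets : List ℕ → List (List ℕ)
subsets [] = [] ∷ []
subsets (x ∷ xs) = subsets xs ++ map (x ∷_) (subsets xs)

-- Ruleset B allowed Q-moves: nonempty sets of legal classical moves with
-- at least two distinct moves, or an unsuperposed move when there is
-- exactly one legal classical move.
allowedQ : List ℕ → List (List ℕ)
allowedQ S = filter (λ M → (2 ℕ.≤? length M) ⊎-dec
                           ((length (legalMoves S) ℕ.≟ 1) ×-dec (length M ℕ.≟ 1)))
                    (subsets (legalMoves S))

applyQ : List ℕ → List ℕ → List ℕ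
applyQ M S = concatMap (λ j → concatMap (λ x → step j x) S) M
  where
  step : ℕ → ℕ → List ℕ
  step j x with j ≤? x
  ... | Relation.Nullary.Decidable.yes _ = (x ∸ j) ∷ []
  ... | Relation.Nullary.Decidable.no _ = []

-- Game tree, by recursion on a fuel bound (fuel ≥ max heap suffices, since
-- every move lowers the max heap by at least 1, and max 0 has no moves).
qTree : ℕ → List ℕ → Game
qTree zero S = node []
qTree (suc f) S = node (map (λ M → qTree f (applyQ M S)) (allowedQ S))

QNimB : List ℕ → Game
QNimB S = qTree (maxL S) S

module Submission where

-- The Q-moves allowed in a superposition S depend only on its largest heap
-- k = maxL S, and a Q-move M lowers the largest heap to something < k; the
-- superposition of the moves m and k lowers it to exactly k ∸ m.  Hence the
-- largest heaps reachable from k ≥ 3 are exactly 1, …, k − 1, from k = 2 only 1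
-- (via {1, 2}), and from k = 1 only 0.  Writing qValue k for the claimed value
-- (0, *, 0, *2, *3, … for k = 0, 1, 2, 3, 4, …), for k ≢ 2 the reachable values
-- are then exactly 0, …, qValue k − 1, so the game has the same options as
-- *(qValue k) up to equivalence; for k = 2 its single option is *, which is
-- reversible, giving 0.  The file first computes largest heaps of applyQ, then
-- the allowed Q-moves and qValue, then two general facts on games (option-wise
-- equivalent games are equivalent; a game with * as only option equals 0), and
-- finally proves qTree f S ≈G *(qValue (maxL S)) by induction on the fuel f.

open import Defs
open import Data.Nat using (ℕ; suc; _≤_; _∸_)
open import Data.List using (List)
open import Data.Product using (_×_)
open import Relation.Binary.PropositionalEquality using (_≡_)

open import Data.Bool using (Bool; true; false; not; _∨_; T)
open import Data.Bool.Properties using (∨-zeroʳ; ∨-assoc)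
open import Data.Empty using (⊥-elim)
open import Data.Bool.ListAction using (any)
open import Data.List using ([]; _∷_; _++_; map; concatMap; filter; length; downFrom)
open import Data.List.Membership.Propositional using (_∈_; find; lose)
open import Data.List.Membership.Propositional.Properties
  using (∈-concatMap⁺; ∈-concatMap⁻; ∈-filter⁺; ∈-filter⁻; ∈-map⁺; ∈-map⁻;
         ∈-++⁺ˡ; ∈-++⁺ʳ; ∈-++⁻; ∈-downFrom⁺; ∈-downFrom⁻)
open import Data.List.Relation.Binary.Sublist.Propositional using (_⊆_; []; _∷ʳ_; _∷_; from∈; ⊆-refl)
open import Data.List.Relation.Binary.Sublist.Propositional.Properties using (Any-resp-⊆; ++⁺)
open import Data.List.Relation.Unary.All using (All; []; _∷_)
open import Data.List.Relation.Unary.Any using (here; there)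
open import Data.List.Relation.Unary.Any.Properties using (any⁺; any⁻)
open import Data.Nat using (zero; _+_; _<_; z≤n; s≤s; s≤s⁻¹; _≤?_; _≟_)
open import Data.Nat.Properties
  using (≤-refl; ≤-trans; ≤-antisym; <-≤-trans; m≤m⊔n; m≤n⊔m; ⊔-lub; n≤0⇒n≡0;
         ∸-mono; ∸-monoʳ-<; m∸[m∸n]≡n; m+[n∸m]≡n; m≤m+n; m≤n+o⇒m∸n≤o;
         +-monoʳ-≤; <⇒≤; m<n⇒0<n∸m; m∸n≤m; ≰⇒>; ≤∧≢⇒<)
open import Data.Product using (Σ-syntax; ∃-syntax; ∃₂; _,_; proj₁)
open import Data.Sum using (_⊎_; inj₁; inj₂)
open import Data.Unit using (tt)
open import Relation.Nullary using (Dec; yes; no)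
open import Relation.Nullary.Decidable using (_⊎-dec_; _×-dec_)
open import Relation.Binary.PropositionalEquality using (_≢_; refl; sym; trans; cong; cong₂; subst; module ≡-Reasoning)

≤-maxL : ∀ {x} S → x ∈ S → x ≤ maxL S
≤-maxL (y ∷ S) (here refl) = m≤m⊔n y (maxL S)
≤-maxL (y ∷ S) (there x∈S) = ≤-trans (≤-maxL S x∈S) (m≤n⊔m y (maxL S))

maxL-≤ : ∀ {b} S → (∀ {x} → x ∈ S → x ≤ b) → maxL S ≤ b
maxL-≤ [] bound = z≤n
maxL-≤ (y ∷ S) bound = ⊔-lub (bound (here refl)) (maxL-≤ S (λ x∈S → bound (there x∈S)))

-- applyQ M S is a double concatMap of a step function that is local to its
-- definition; naming it lets us compute the members of applyQ M S.

applyQ-as-concatMap : ∀ M S → Σ[ step ∈ (ℕ → ℕ → List ℕ) ] applyQ M S ≡ concatMap (λ j → concatMap (step j) S) M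
applyQ-as-concatMap M S = _ , refl

heapStep : List ℕ → List ℕ → ℕ → ℕ → List ℕ
heapStep M S = proj₁ (applyQ-as-concatMap M S)

∈-heapStep⁺ : ∀ {j x} M S → j ≤ x → x ∸ j ∈ heapStep M S j x
∈-heapStep⁺ {j} {x} M S j≤x with j ≤? x
... | yes _ = here refl
... | no j≰x = ⊥-elim (j≰x j≤x)

∈-heapStep⁻ : ∀ {j x y} M S → y ∈ heapStep M S j x → j ≤ x × y ≡ x ∸ j
∈-heapStep⁻ {j} {x} M S y∈ with j ≤? x | y∈
... | yes j≤x | here y≡x∸j = j≤x , y≡x∸j

∈-applyQ⁺ : ∀ {j x} M S → j ∈ M → x ∈ S → j ≤ x → x ∸ j ∈ applyQ M S
∈-applyQ⁺ M S j∈M x∈S j≤x =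
  ∈-concatMap⁺ _ (lose j∈M (∈-concatMap⁺ _ (lose x∈S (∈-heapStep⁺ M S j≤x))))

∈-applyQ⁻ : ∀ {y} M S → y ∈ applyQ M S → ∃₂ λ j x → j ∈ M × x ∈ S × j ≤ x × y ≡ x ∸ j
∈-applyQ⁻ M S y∈
  with j , j∈M , y∈′ ← find (∈-concatMap⁻ _ {xs = M} y∈)
  with x , x∈S , y∈″ ← find (∈-concatMap⁻ _ {xs = S} y∈′)
  with j≤x , refl ← ∈-heapStep⁻ {j} {x} M S y∈″ = j , x , j∈M , x∈S , j≤x , refl

applyQ-maxL-≤ : ∀ {m} M S → (∀ {j} → j ∈ M → m ≤ j) → maxL (applyQ M S) ≤ maxL S ∸ m
applyQ-maxL-≤ {m} M S m≤M = maxL-≤ (applyQ M S) bound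
  where
  bound : ∀ {y} → y ∈ applyQ M S → y ≤ maxL S ∸ m
  bound y∈ with _ , _ , j∈M , x∈S , _ , refl ← ∈-applyQ⁻ M S y∈ = ∸-mono (≤-maxL S x∈S) (m≤M j∈M)

applyQ-maxL-≥ : ∀ {m} M S → m ∈ M → maxL S ∸ m ≤ maxL (applyQ M S)
applyQ-maxL-≥ {m} M S m∈M = m≤n+o⇒m∸n≤o (maxL S) m (maxL-≤ S bound)
  where
  bound : ∀ {x} → x ∈ S → x ≤ m + maxL (applyQ M S)
  bound {x} x∈S with m ≤? x
  ... | yes m≤x = subst (_≤ m + _) (m+[n∸m]≡n m≤x)
                    (+-monoʳ-≤ m (≤-maxL (applyQ M S) (∈-applyQ⁺ M S m∈M x∈S m≤x)))
  ... | no m≰x = ≤-trans (<⇒≤ (≰⇒> m≰x)) (m≤m+n m _)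

pair-maxL : ∀ {m k} S → maxL S ≡ k → m ≤ k → maxL (applyQ (m ∷ k ∷ []) S) ≡ k ∸ m
pair-maxL {m} {k} S refl m≤k = ≤-antisym
  (applyQ-maxL-≤ (m ∷ k ∷ []) S λ { (here refl) → ≤-refl ; (there (here refl)) → m≤k })
  (applyQ-maxL-≥ (m ∷ k ∷ []) S (here refl))

subsets-sound : ∀ {A} xs → A ∈ subsets xs → A ⊆ xs
subsets-sound [] (here refl) = []
subsets-sound (x ∷ xs) A∈ with ∈-++⁻ (subsets xs) A∈
... | inj₁ A∈′ = x ∷ʳ subsets-sound xs A∈′
... | inj₂ A∈′ with _ , A′∈ , refl ← ∈-map⁻ (x ∷_) A∈′ = refl ∷ subsets-sound xs A′∈

subsets-complete : ∀ {A} xs → A ⊆ xs → A ∈ subsets xs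
subsets-complete [] [] = here refl
subsets-complete (x ∷ xs) (.x ∷ʳ A⊆) = ∈-++⁺ˡ (subsets-complete xs A⊆)
subsets-complete (x ∷ xs) (refl ∷ A⊆) = ∈-++⁺ʳ (subsets xs) (∈-map⁺ (x ∷_) (subsets-complete xs A⊆))

∈-oneTo⁺ : ∀ {m} k → 1 ≤ m → m ≤ k → m ∈ oneTo k
∈-oneTo⁺ {m} (suc k) 1≤m m≤1+k with m ≟ suc k
... | yes refl = ∈-++⁺ʳ (oneTo k) (here refl)
... | no m≢1+k = ∈-++⁺ˡ (∈-oneTo⁺ k 1≤m (s≤s⁻¹ (≤∧≢⇒< m≤1+k m≢1+k)))
∈-oneTo⁺ zero (s≤s _) ()

∈-oneTo⁻ : ∀ {m} k → m ∈ oneTo k → 1 ≤ m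
∈-oneTo⁻ (suc k) m∈ with ∈-++⁻ (oneTo k) m∈
... | inj₁ m∈′ = ∈-oneTo⁻ k m∈′
... | inj₂ (here refl) = s≤s z≤n

-- The Q-moves allowed in Ruleset B depend on the position S only through its
-- largest heap k: allowedQ S is definitionally Qmoves (maxL S).

IsQmove : ℕ → List ℕ → Set
IsQmove k M = 2 ≤ length M ⊎ (length (oneTo k) ≡ 1 × length M ≡ 1)

isQmove? : ∀ k (M : List ℕ) → Dec (IsQmove k M)
isQmove? k M = (2 ≤? length M) ⊎-dec ((length (oneTo k) ≟ 1) ×-dec (length M ≟ 1))

Qmoves : ℕ → List (List ℕ)
Qmoves k = filter (isQmove? k) (subsets (oneTo k))

Qmove-positive : ∀ {k M j} → M ∈ Qmoves k → j ∈ M → 1 ≤ j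
Qmove-positive {k} M∈ j∈M =
  ∈-oneTo⁻ k (Any-resp-⊆ (subsets-sound (oneTo k) (proj₁ (∈-filter⁻ (isQmove? k) M∈))) j∈M)

Qmoves-nonzero : ∀ {k M} → M ∈ Qmoves k → 1 ≤ k
Qmoves-nonzero {suc k} _ = s≤s z≤n

Qmove-lowers : ∀ {M} S → M ∈ Qmoves (maxL S) → maxL (applyQ M S) < maxL S
Qmove-lowers {M} S M∈ =
  <-≤-trans (s≤s (applyQ-maxL-≤ M S (Qmove-positive {maxL S} M∈)))
            (∸-monoʳ-< (s≤s z≤n) (Qmoves-nonzero {maxL S} M∈))

pair-Qmove : ∀ {m} k → 1 ≤ m → m < k → (m ∷ k ∷ []) ∈ Qmoves k
pair-Qmove (suc k) 1≤m (s≤s m≤k) =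
  ∈-filter⁺ (isQmove? (suc k))
    (subsets-complete (oneTo (suc k)) (++⁺ (from∈ (∈-oneTo⁺ k 1≤m m≤k)) ⊆-refl))
    (inj₁ (s≤s (s≤s z≤n)))

qValue : ℕ → ℕ
qValue 0 = 0
qValue 1 = 1
qValue 2 = 0
qValue (suc (suc (suc n))) = suc (suc n)

qValue-≥3 : ∀ {k} → 3 ≤ k → qValue k ≡ k ∸ 1
qValue-≥3 {suc zero} (s≤s ())
qValue-≥3 {suc (suc zero)} (s≤s (s≤s ()))
qValue-≥3 {suc (suc (suc n))} _ = refl

qValue-below : ∀ {t k} → t < k → k ≢ 2 → qValue t < qValue k
qValue-below {zero} {suc zero} _ _ = s≤s z≤n
qValue-below {suc _} {suc zero} (s≤s ()) _
qValue-below {_} {suc (suc zero)} _ k≢2 = ⊥-elim (k≢2 refl)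
qValue-below {zero} {suc (suc (suc n))} _ _ = s≤s z≤n
qValue-below {suc zero} {suc (suc (suc n))} _ _ = s≤s (s≤s z≤n)
qValue-below {suc (suc zero)} {suc (suc (suc n))} _ _ = s≤s z≤n
qValue-below {suc (suc (suc t))} {suc (suc (suc n))} (s≤s t<k) _ = t<k

qValue-attained : ∀ n {i} → i < qValue (3 + n) → ∃[ t ] 1 ≤ t × t < 3 + n × qValue t ≡ i
qValue-attained n {zero} _ = 2 , s≤s z≤n , s≤s (s≤s (s≤s z≤n)) , refl
qValue-attained n {suc zero} _ = 1 , s≤s z≤n , s≤s (s≤s z≤n) , refl
qValue-attained n {suc (suc i)} i<2+n = 3 + i , s≤s z≤n , s≤s i<2+n , refl

reachedValue-below : ∀ {M} S → M ∈ Qmoves (maxL S) → maxL S ≢ 2 →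
  qValue (maxL (applyQ M S)) < qValue (maxL S)
reachedValue-below S M∈ k≢2 = qValue-below (Qmove-lowers S M∈) k≢2

valuesReached : ∀ {i} k S → maxL S ≡ k → k ≢ 2 → i < qValue k →
  ∃[ M ] M ∈ Qmoves k × qValue (maxL (applyQ M S)) ≡ i
valuesReached (suc zero) S k≡1 _ (s≤s z≤n) =
  1 ∷ [] , here refl , cong qValue (n≤0⇒n≡0 drop)
  where
  drop : maxL (applyQ (1 ∷ []) S) ≤ 0
  drop = subst (λ k → maxL (applyQ (1 ∷ []) S) ≤ k ∸ 1) k≡1
           (applyQ-maxL-≤ (1 ∷ []) S λ { (here refl) → ≤-refl })
valuesReached (suc (suc zero)) S _ k≢2 _ = ⊥-elim (k≢2 refl)
valuesReached {i} k@(suc (suc (suc n))) S k≡ _ i<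
  with t , 1≤t , t<k , qt≡i ← qValue-attained n i< =
  k ∸ t ∷ k ∷ [] , pair-Qmove k (m<n⇒0<n∸m t<k) (∸-monoʳ-< 1≤t (<⇒≤ t<k)) , reachesT
  where
  reachesT : qValue (maxL (applyQ (k ∸ t ∷ k ∷ []) S)) ≡ i
  reachesT = begin
    qValue (maxL (applyQ (k ∸ t ∷ k ∷ []) S)) ≡⟨ cong qValue (pair-maxL S k≡ (m∸n≤m k t)) ⟩
    qValue (k ∸ (k ∸ t))                      ≡⟨ cong qValue (m∸[m∸n]≡n (<⇒≤ t<k)) ⟩
    qValue t                                  ≡⟨ qt≡i ⟩
    i                                         ∎
    where open ≡-Reasoning

someLoses-++ : ∀ gs hs → someLoses (gs ++ hs) ≡ someLoses gs ∨ someLoses hs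
someLoses-++ [] hs = refl
someLoses-++ (g ∷ gs) hs =
  trans (cong (not (wins g) ∨_) (someLoses-++ gs hs)) (sym (∨-assoc (not (wins g)) (someLoses gs) (someLoses hs)))

someLoses-lefts : ∀ gs X → someLoses (lefts gs X) ≡ any (λ g → not (wins (g ⊕ X))) gs
someLoses-lefts [] X = refl
someLoses-lefts (g ∷ gs) X = cong (not (wins (g ⊕ X)) ∨_) (someLoses-lefts gs X)

someLoses-rights : ∀ G xs → someLoses (rights G xs) ≡ any (λ x → not (wins (G ⊕ x))) xs
someLoses-rights G [] = refl
someLoses-rights G (x ∷ xs) = cong (not (wins (G ⊕ x)) ∨_) (someLoses-rights G xs)

wins-⊕ : ∀ gs xs → wins (node gs ⊕ node xs) ≡
  any (λ g → not (wins (g ⊕ node xs))) gs ∨ any (λ x → not (wins (node gs ⊕ x))) xs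
wins-⊕ gs xs = trans (someLoses-++ (lefts gs (node xs)) (rights (node gs) xs))
                     (cong₂ _∨_ (someLoses-lefts gs (node xs)) (someLoses-rights (node gs) xs))

AgreeOn : Game → Game → Game → Set
AgreeOn G H X = wins (G ⊕ X) ≡ wins (H ⊕ X)

InductionStep : Game → Game → Set
InductionStep G H = ∀ xs → All (AgreeOn G H) xs → AgreeOn G H (node xs)

mutual
  ≈G-induction : ∀ G H → InductionStep G H → G ≈G H
  ≈G-induction G H step (node xs) = step xs (agreeOnOptions G H step xs)

  agreeOnOptions : ∀ G H → InductionStep G H → ∀ xs → All (AgreeOn G H) xs
  agreeOnOptions G H step [] = []
  agreeOnOptions G H step (x ∷ xs) = ≈G-induction G H step x ∷ agreeOnOptions G H step xs

rightsAgree : ∀ G H {xs} → All (AgreeOn G H) xs →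
  any (λ x → not (wins (G ⊕ x))) xs ≡ any (λ x → not (wins (H ⊕ x))) xs
rightsAgree G H [] = refl
rightsAgree G H (e ∷ es) = cong₂ (λ a b → not a ∨ b) e (rightsAgree G H es)

T-ext : ∀ {a b} → (T a → T b) → (T b → T a) → a ≡ b
T-ext {false} {false} _ _ = refl
T-ext {false} {true} _ b⇒a = ⊥-elim (b⇒a tt)
T-ext {true} {false} a⇒b _ = ⊥-elim (a⇒b tt)
T-ext {true} {true} _ _ = refl

any-transfer : ∀ {A B : Set} (p : A → Bool) (q : B → Bool) {as bs} →
  (∀ {a} → a ∈ as → ∃[ b ] b ∈ bs × p a ≡ q b) → T (any p as) → T (any q bs)
any-transfer p q {as} match holds
  with a , a∈ , pa ← find (any⁻ p as holds)
  with b , b∈ , pa≡qb ← match a∈ = any⁺ q (lose b∈ (subst T pa≡qb pa))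

any-matched : ∀ {A B : Set} (p : A → Bool) (q : B → Bool) {as bs} →
  (∀ {a} → a ∈ as → ∃[ b ] b ∈ bs × p a ≡ q b) →
  (∀ {b} → b ∈ bs → ∃[ a ] a ∈ as × p a ≡ q b) → any p as ≡ any q bs
any-matched p q to from = T-ext (any-transfer p q to) (any-transfer q p from′)
  where
  from′ : ∀ {b} → b ∈ _ → ∃[ a ] a ∈ _ × q b ≡ p a
  from′ b∈ with a , a∈ , pa≡qb ← from b∈ = a , a∈ , sym pa≡qb

_≈opts_ : List Game → List Game → Set
gs ≈opts hs = (∀ {g} → g ∈ gs → ∃[ h ] h ∈ hs × g ≈G h)
            × (∀ {h} → h ∈ hs → ∃[ g ] g ∈ gs × g ≈G h)

optionsCongruence : ∀ {gs hs} → gs ≈opts hs → node gs ≈G node hs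
optionsCongruence {gs} {hs} (to , from) = ≈G-induction (node gs) (node hs) step
  where
  step : InductionStep (node gs) (node hs)
  step xs ih = begin
    wins (node gs ⊕ node xs)
      ≡⟨ wins-⊕ gs xs ⟩
    any (λ g → not (wins (g ⊕ node xs))) gs ∨ any (λ x → not (wins (node gs ⊕ x))) xs
      ≡⟨ cong₂ _∨_ (any-matched _ _ toLosing fromLosing) (rightsAgree (node gs) (node hs) ih) ⟩
    any (λ h → not (wins (h ⊕ node xs))) hs ∨ any (λ x → not (wins (node hs ⊕ x))) xs
      ≡⟨ sym (wins-⊕ hs xs) ⟩
    wins (node hs ⊕ node xs) ∎
    where
    open ≡-Reasoning
    toLosing : ∀ {g} → g ∈ gs → ∃[ h ] h ∈ hs × not (wins (g ⊕ node xs)) ≡ not (wins (h ⊕ node xs))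
    toLosing g∈ with h , h∈ , g≈h ← to g∈ = h , h∈ , cong not (g≈h (node xs))
    fromLosing : ∀ {h} → h ∈ hs → ∃[ g ] g ∈ gs × not (wins (g ⊕ node xs)) ≡ not (wins (h ⊕ node xs))
    fromLosing h∈ with g , g∈ , g≈h ← from h∈ = g , g∈ , cong not (g≈h (node xs))

nims-downFrom : ∀ n → nims n ≡ map nim (downFrom n)
nims-downFrom zero = refl
nims-downFrom (suc n) = cong (nim n ∷_) (nims-downFrom n)

∈-nims⁺ : ∀ {i n} → i < n → nim i ∈ nims n
∈-nims⁺ {i} {n} i<n = subst (nim i ∈_) (sym (nims-downFrom n)) (∈-map⁺ nim (∈-downFrom⁺ i<n))

∈-nims⁻ : ∀ {g n} → g ∈ nims n → ∃[ i ] i < n × g ≡ nim i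
∈-nims⁻ {g} {n} g∈ with i , i∈ , refl ← ∈-map⁻ nim (subst (g ∈_) (nims-downFrom n) g∈) =
  i , ∈-downFrom⁻ i∈ , refl

-- A game whose only option is * is equivalent to 0: the move to * is reversed
-- by the reply from * to 0.

star-wins : ∀ X → wins (nim 0 ⊕ X) ≡ false → wins (nim 1 ⊕ X) ≡ true
star-wins (node xs) zeroLoses = begin
  wins (nim 1 ⊕ node xs)
    ≡⟨ wins-⊕ (nim 0 ∷ []) xs ⟩
  (not (wins (nim 0 ⊕ node xs)) ∨ false) ∨ any (λ x → not (wins (nim 1 ⊕ x))) xs
    ≡⟨ cong (λ b → (not b ∨ false) ∨ any (λ x → not (wins (nim 1 ⊕ x))) xs) zeroLoses ⟩
  true ∎
  where open ≡-Reasoning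

reversed : ∀ a w → (w ≡ false → a ≡ true) → (not a ∨ false) ∨ w ≡ w
reversed a true _ = ∨-zeroʳ _
reversed a false a-wins rewrite a-wins refl = refl

onlyOptionStar : ∀ g → g ≈G nim 1 → node (g ∷ []) ≈G nim 0
onlyOptionStar g g≈* = ≈G-induction (node (g ∷ [])) (nim 0) step
  where
  step : InductionStep (node (g ∷ [])) (nim 0)
  step xs ih = begin
    wins (node (g ∷ []) ⊕ node xs)
      ≡⟨ wins-⊕ (g ∷ []) xs ⟩
    (not (wins (g ⊕ node xs)) ∨ false) ∨ any (λ x → not (wins (node (g ∷ []) ⊕ x))) xs
      ≡⟨ cong₂ (λ a b → (not a ∨ false) ∨ b) (g≈* (node xs)) (rightsAgree (node (g ∷ [])) (nim 0) ih) ⟩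
    (not (wins (nim 1 ⊕ node xs)) ∨ false) ∨ any (λ x → not (wins (nim 0 ⊕ x))) xs
      ≡⟨ cong ((not (wins (nim 1 ⊕ node xs)) ∨ false) ∨_) (sym (wins-⊕ [] xs)) ⟩
    (not (wins (nim 1 ⊕ node xs)) ∨ false) ∨ wins (nim 0 ⊕ node xs)
      ≡⟨ reversed (wins (nim 1 ⊕ node xs)) (wins (nim 0 ⊕ node xs)) (star-wins (node xs)) ⟩
    wins (nim 0 ⊕ node xs) ∎
    where open ≡-Reasoning

ValuedOptions : List ℕ → (List ℕ → Game) → Set
ValuedOptions S option =
  ∀ {M} → M ∈ Qmoves (maxL S) → option M ≈G nim (qValue (maxL (applyQ M S)))

options-match : ∀ S option → maxL S ≢ 2 → ValuedOptions S option →
  map option (Qmoves (maxL S)) ≈opts nims (qValue (maxL S))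
options-match S option k≢2 valued = to , from
  where
  to : ∀ {g} → g ∈ map option (Qmoves (maxL S)) → ∃[ h ] h ∈ nims (qValue (maxL S)) × g ≈G h
  to g∈ with M , M∈ , refl ← ∈-map⁻ option g∈ =
    nim _ , ∈-nims⁺ (reachedValue-below S M∈ k≢2) , valued M∈
  from : ∀ {h} → h ∈ nims (qValue (maxL S)) → ∃[ g ] g ∈ map option (Qmoves (maxL S)) × g ≈G h
  from h∈ with i , i< , refl ← ∈-nims⁻ h∈
          with M , M∈ , value≡i ← valuesReached (maxL S) S refl k≢2 i< =
    option M , ∈-map⁺ option M∈ , subst (λ n → option M ≈G nim n) value≡i (valued M∈)

-- For k = 2 the only allowed Q-move is {1, 2}, leading to largest heap 1, i.e. to *.
onlyOption-at-2 : ∀ S option → maxL S ≡ 2 → ValuedOptions S option →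
  node (map option (Qmoves (maxL S))) ≈G nim (qValue (maxL S))
onlyOption-at-2 S option k≡2 valued =
  subst (λ k → node (map option (Qmoves k)) ≈G nim (qValue k)) (sym k≡2)
        (onlyOptionStar (option (1 ∷ 2 ∷ [])) starOption)
  where
  starOption : option (1 ∷ 2 ∷ []) ≈G nim 1
  starOption = subst (λ t → option (1 ∷ 2 ∷ []) ≈G nim (qValue t)) (pair-maxL S k≡2 (s≤s z≤n))
                     (valued (subst (λ k → (1 ∷ 2 ∷ []) ∈ Qmoves k) (sym k≡2) (here refl)))

superposition-step : ∀ S option → ValuedOptions S option →
  node (map option (Qmoves (maxL S))) ≈G nim (qValue (maxL S))
superposition-step S option valued with maxL S ≟ 2
... | yes k≡2 = onlyOption-at-2 S option k≡2 valued
... | no k≢2 = optionsCongruence (options-match S option k≢2 valued)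

superposition-value : ∀ f S → maxL S ≤ f → qTree f S ≈G nim (qValue (maxL S))
superposition-value zero S k≤0 X rewrite n≤0⇒n≡0 k≤0 = refl
superposition-value (suc f) S k≤1+f = superposition-step S (λ M → qTree f (applyQ M S)) valued
  where
  valued : ValuedOptions S (λ M → qTree f (applyQ M S))
  valued {M} M∈ = superposition-value f (applyQ M S) (s≤s⁻¹ (<-≤-trans (Qmove-lowers S M∈) k≤1+f))

mainTheorem5 : (S : List ℕ) → 1 ≤ maxL S →
    ((maxL S ≡ 2 → QNimB S ≈G nim 0)
    × (maxL S ≡ 1 → QNimB S ≈G nim 1)
    × (3 ≤ maxL S → QNimB S ≈G nim (maxL S ∸ 1)))
mainTheorem5 S _ =
  (λ k≡2 → valueIs (cong qValue k≡2)) ,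
  (λ k≡1 → valueIs (cong qValue k≡1)) ,
  (λ 3≤k → valueIs (qValue-≥3 3≤k))
  where
  valueIs : ∀ {n} → qValue (maxL S) ≡ n → QNimB S ≈G nim n
  valueIs eq = subst (λ n → QNimB S ≈G nim n) eq (superposition-value (maxL S) S ≤-refl)
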